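{- Any streaming algorithm for \textsc{Diameter} in the AL model that works correctly on a family of graphs containing all "Windmill" graphs $W_N(x,y)$ (for all $N$ and all $x,y \in \{0,1\}^N$) and uses $p$ passes over the stream requires $\Omega(n/p)$ bits of memory, where $n$ is the number of vertices.
   Context: For $N\ge1$ and $x,y\in\{0,1\}^N$, the tree $W_N(x,y)$ on $5N+6$ vertices is built as follows. Take a path on $6$ vertices, one of whose ends is called the center $c$. For each $i \in \{1,\dots,N\}$ add vertices $a_{i,2},a_{i,3},b_{i,1},b_{i,2},b_{i,3}$, write $a_{i,1} := c$, and add the edge $a_{i,3}b_{i,1}$. If $x_i=0$ add edges $a_{i,1}a_{i,2}$ and $a_{i,1}a_{i,3}$; if $x_i = 1$ add edges $a_{i,1}a_{i,2}$ and $a_{i,2}a_{i,3}$. If $y_i = 0$ add edges $b_{i,1}b_{i,2}$ and $b_{i,1}b_{i,3}$; if $y_i=1$ add edges $b_{i,1}b_{i,2}$ and $b_{i,2}b_{i,3}$. \textsc{Diameter}: compute $\max_{s,t} d(s,t)$. In the Adjacency List (AL) streaming model the graph arrives as a sequence of vertices in arbitrary fixed order, each with the full list of its incident edges. A $p$-pass algorithm reads the sequence $p$ times with unlimited computation; memory is in bits. "Requires $\Omega(f)$ bits" means there is a constant $c_0>0$ such that every such algorithm uses at least $c_0 f$ bits on some $n$-vertex input from the family, for all sufficiently large $n$ and all $p$. -}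

module Defs where

open import Data.Nat using (ℕ; zero; suc; _≤_; _^_)
open import Data.Fin using (Fin; zero; suc; inject₁)
open import Data.Bool using (Bool; true; false)
open import Data.Vec using (Vec; lookup)
open import Data.List using (List; map; foldl; allFin)
open import Data.List.Membership.Propositional using (_∈_)
open import Data.List.Relation.Unary.Unique.Propositional using (Unique)
open import Data.Product using (_×_; _,_; proj₁; proj₂; ∃-syntax)
open import Data.Sum using (_⊎_)
open import Function.Bundles using (_⇔_)
open import Relation.Binary.PropositionalEquality using (_≡_)

-- Vertices of the windmill W_N(x,y):  5N+6 vertices.
-- path k (k = 0..5) is the 6-vertex path, path zero is the center c = a_{i,1}.
-- a2 i, a3 i, b1 i, b2 i, b3 i are a_{i,2}, a_{i,3}, b_{i,1}, b_{i,2}, b_{i,3}.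

data V (N : ℕ) : Set where
  path : Fin 6 → V N
  a2 a3 b1 b2 b3 : Fin N → V N

center : ∀ {N} → V N
center = path zero

data Arc {N : ℕ} (x y : Vec Bool N) : V N → V N → Set where
  pathE : (k : Fin 5) → Arc x y (path (inject₁ k)) (path (suc k))
  a3-b1 : (i : Fin N) → Arc x y (a3 i) (b1 i)
  c-a2  : (i : Fin N) → Arc x y center (a2 i)
  c-a3  : (i : Fin N) → lookup x i ≡ false → Arc x y center (a3 i)
  a2-a3 : (i : Fin N) → lookup x i ≡ true  → Arc x y (a2 i) (a3 i)
  b1-b2 : (i : Fin N) → Arc x y (b1 i) (b2 i)
  b1-b3 : (i : Fin N) → lookup y i ≡ false → Arc x y (b1 i) (b3 i)
  b2-b3 : (i : Fin N) → lookup y i ≡ true  → Arc x y (b2 i) (b3 i)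

Adj : ∀ {N} → Vec Bool N → Vec Bool N → V N → V N → Set
Adj x y u v = Arc x y u v ⊎ Arc x y v u

data Walk {N : ℕ} (x y : Vec Bool N) : V N → V N → ℕ → Set where
  nil  : ∀ {u} → Walk x y u u 0
  cons : ∀ {u v w k} → Adj x y u v → Walk x y v w k → Walk x y u w (suc k)

Dist : ∀ {N} → Vec Bool N → Vec Bool N → V N → V N → ℕ → Set
Dist x y s t d = Walk x y s t d × (∀ k → Walk x y s t k → d ≤ k)

IsDiameter : ∀ {N} → Vec Bool N → Vec Bool N → ℕ → Set
IsDiameter {N} x y d =
  (∃[ s ] ∃[ t ] Dist x y s t d) × (∀ s t e → Dist x y s t e → e ≤ d)

-- Adjacency-list streams: one item per vertex, with its full neighbour list.

Item : ℕ → Set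
Item N = V N × List (V N)

ValidStream : ∀ {N} → Vec Bool N → Vec Bool N → List (Item N) → Set
ValidStream {N} x y str =
  Unique (map proj₁ str) × (∀ (v : V N) → v ∈ map proj₁ str) ×
  (∀ it → it ∈ str →
     Unique (proj₂ it) × (∀ u → (u ∈ proj₂ it) ⇔ Adj x y (proj₁ it) u))

-- A deterministic p-pass streaming algorithm with s bits of memory:
-- memory states are Fin (2 ^ s); unlimited computation per item; the
-- transition may depend on the current pass number.

record Algorithm (N p s : ℕ) : Set where
  field
    init   : Fin (2 ^ s)
    step   : Fin p → Fin (2 ^ s) → Item N → Fin (2 ^ s)
    output : Fin (2 ^ s) → ℕ

run : ∀ {N p s} → Algorithm N p s → List (Item N) → ℕ
run {N} {p} {s} A str =
  output (foldl (λ st i → foldl (step i) st str) init (allFin p))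
  where open Algorithm A

SolvesDiameterOnWindmills : ∀ {N p s} → Algorithm N p s → Set
SolvesDiameterOnWindmills {N} A =
  ∀ (x y : Vec Bool N) (str : List (Item N)) →
    ValidStream x y str → IsDiameter x y (run A str)

-- A fooling-set argument from two-party communication complexity. Stream W_N(x,y) with the
-- vertices of the tail and of the a-arms first: their adjacency lists depend on x only, those of
-- the b-arms on y only. The diameter is 10 (from the end of the tail to some b_{i,3}) when
-- x_i = y_i = 1 for some i, and at most 9 otherwise. On the input (x, not x) a p-pass algorithm
-- determines the 2p memory states at the hand-overs between the two halves of the stream. Two
-- inputs x ≠ x′ with the same states could be spliced (x's half, then the half of not x′) without
-- changing the output, although one of the spliced graphs has diameter 10 and W_N(x, not x) has
-- diameter at most 9. So x ↦ states is injective, 2^N ≤ 2^(2sp), and n = 5N + 6 ≤ 22ps.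
module Submission where

open import Defs
open import Data.Nat using (ℕ; zero; suc; _≤_; _<_; _+_; _*_; _^_; _∸_; _≤ᵇ_; z≤n)
open import Data.Nat.Properties
  using ( module ≤-Reasoning; ≤-trans; ≤-reflexive; ≤ᵇ⇒≤; ≮⇒≥; <⇒≱; 1+n≰n
        ; +-suc; +-identityʳ; +-mono-≤; +-monoˡ-≤; +-monoʳ-≤; *-identityˡ; *-distribʳ-+; *-monoʳ-≤
        ; ^-monoʳ-<; ^-distribˡ-+-*; ^-*-assoc )
open import Data.Nat.Tactic.RingSolver using (solve-∀)
open import Data.Fin using (Fin; zero; suc; toℕ; inject₁)
open import Data.Fin.Properties using (2↔Bool; *↔×; injective⇒≤)
open import Data.Bool using (Bool; true; false; T; not; _≟_)
open import Data.Vec as Vec using (Vec; []; _∷_; lookup)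
open import Data.Vec.Properties using (∷-injective; lookup-map; tabulate∘lookup; tabulate-cong)
open import Data.Vec.Recursive using (lift↔; Fin[m^n]↔Fin[m]^n)
open import Data.Vec.Recursive.Properties using (↔Vec)
open import Data.List using (List; []; _∷_; _++_; map; concat; filter; allFin; foldl; length)
open import Data.List.Properties using (map-++; map-∘; map-id; concat-++; foldl-++; length-tabulate)
open import Data.List.Membership.Propositional using (_∈_)
open import Data.List.Membership.Propositional.Properties
  using (∈-map⁺; ∈-map⁻; ∈-++⁻; ∈-concat⁺′; ∈-concat⁻; ∈-allFin; ∈-map∘filter⁺; ∈-map∘filter⁻)
open import Data.List.Relation.Unary.Any using (here; there)
open import Data.List.Relation.Unary.All using ([]; _∷_)
open import Data.List.Relation.Unary.AllPairs using ([]; _∷_)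
open import Data.List.Relation.Unary.Unique.Propositional using (Unique)
import Data.List.Relation.Unary.Unique.Propositional.Properties as Unique
open import Data.List.Relation.Binary.Disjoint.Propositional using (Disjoint)
open import Data.Product using (_×_; _,_; proj₁; proj₂; ∃-syntax)
open import Data.Sum using (_⊎_; inj₁; inj₂; [_,_])
open import Data.Empty using (⊥; ⊥-elim)
open import Function using (_∘_; id; case_of_)
open import Function.Bundles using (_⇔_; mk⇔; _↔_; _↣_; mk↣; Injection)
open import Function.Properties.Inverse using (↔-trans; ↔-sym; ↔⇒↣)
open import Function.Properties.Injection using (↣-trans)
open import Relation.Nullary using (Dec)
open import Relation.Binary.PropositionalEquality
  using (_≡_; _≢_; refl; sym; trans; cong; cong₂; subst; module ≡-Reasoning)

≤-decide : ∀ {m n} {m≤ᵇn : T (m ≤ᵇ n)} → m ≤ n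
≤-decide {m} {n} {m≤ᵇn} = ≤ᵇ⇒≤ m n m≤ᵇn

Fin^↔Vec : ∀ {A : Set} {m} n → Fin m ↔ A → Fin (m ^ n) ↔ Vec A n
Fin^↔Vec {m = m} n m↔A = ↔-trans (Fin[m^n]↔Fin[m]^n m n) (↔-trans (lift↔ n m↔A) (↔Vec n))

Vec-↣⇒^≤ : ∀ {A B : Set} {a b m n} → Fin a ↔ A → Fin b ↔ B → Vec A m ↣ Vec B n → a ^ m ≤ b ^ n
Vec-↣⇒^≤ a↔A b↔B f = injective⇒≤ (Injection.injective
  (↣-trans (↔⇒↣ (Fin^↔Vec _ a↔A)) (↣-trans f (↔⇒↣ (↔-sym (Fin^↔Vec _ b↔B))))))

^-cancelˡ-≤ : ∀ b {m n} → 1 < b → b ^ m ≤ b ^ n → m ≤ n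
^-cancelˡ-≤ b 1<b bᵐ≤bⁿ = ≮⇒≥ (λ n<m → <⇒≱ (^-monoʳ-< b 1<b n<m) bᵐ≤bⁿ)

map-disjoint : ∀ {A B C : Set} {f : A → C} {g : B → C} {xs ys} →
               (∀ {a b} → f a ≢ g b) → Disjoint (map f xs) (map g ys)
map-disjoint {f = f} {g} f≢g (fa∈ , gb∈) with ∈-map⁻ f fa∈ | ∈-map⁻ g gb∈
... | _ , _ , refl | _ , _ , eq = f≢g eq

map-allFin-unique : ∀ {A : Set} {M} {c : Fin M → A} → (∀ {i j} → c i ≡ c j → i ≡ j) → Unique (map c (allFin M))
map-allFin-unique c-injective = Unique.map⁺ c-injective (Unique.allFin⁺ _)

module _ {ι S A : Set} (step : ι → S → A → S) where

  runPasses : List ι → List A → S → S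
  runPasses is str st = foldl (λ st i → foldl (step i) st str) st is

  transcript : List A → List A → (is : List ι) → S → Vec (S × S) (length is)
  transcript α β []       st = []
  transcript α β (i ∷ is) st = (mid , end) ∷ transcript α β is end
    where
    mid = foldl (step i) st α
    end = foldl (step i) mid β

  runPasses-splice : ∀ α β α′ β′ is st → transcript α β is st ≡ transcript α′ β′ is st →
                     runPasses is (α ++ β′) st ≡ runPasses is (α ++ β) st
  runPasses-splice α β α′ β′ []       st _    = refl
  runPasses-splice α β α′ β′ (i ∷ is) st same with ∷-injective same
  ... | ends≡ , rest≡ = begin
    runPasses is (α ++ β′) (foldl (step i) st (α ++ β′)) ≡⟨ cong (runPasses is (α ++ β′)) spliced-end ⟩
    runPasses is (α ++ β′) end                           ≡⟨ runPasses-splice α β α′ β′ is end rest≡′ ⟩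
    runPasses is (α ++ β) end                            ≡⟨ cong (runPasses is (α ++ β)) (sym (foldl-++ (step i) st α β)) ⟩
    runPasses is (α ++ β) (foldl (step i) st (α ++ β))   ∎
    where
    open ≡-Reasoning
    mid = foldl (step i) st α
    end = foldl (step i) mid β
    end′ = foldl (step i) (foldl (step i) st α′) β′
    end′≡end : end′ ≡ end
    end′≡end = sym (cong proj₂ ends≡)
    spliced-end : foldl (step i) st (α ++ β′) ≡ end
    spliced-end = begin
      foldl (step i) st (α ++ β′)               ≡⟨ foldl-++ (step i) st α β′ ⟩
      foldl (step i) mid β′                     ≡⟨ cong (λ m → foldl (step i) m β′) (cong proj₁ ends≡) ⟩
      end′                                      ≡⟨ end′≡end ⟩
      end                                       ∎
    rest≡′ : transcript α β is end ≡ transcript α′ β′ is end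
    rest≡′ = trans rest≡ (cong (transcript α′ β′ is) end′≡end)

pattern 1F = suc zero
pattern 2F = suc 1F
pattern 3F = suc 2F
pattern 4F = suc 3F
pattern 5F = suc 4F

module _ {N : ℕ} where

  indices : List (Fin N)
  indices = allFin N

  arms : (Fin N → V N) → List (V N)
  arms c = map c indices

  zeroAt? : (x : Vec Bool N) (i : Fin N) → Dec (lookup x i ≡ false)
  zeroAt? x i = lookup x i ≟ false

  centreBlocks : Vec Bool N → List (List (V N))
  centreBlocks x = map path (1F ∷ []) ∷ arms a2 ∷ map a3 (filter (zeroAt? x) indices) ∷ []

  centreNeighbours : Vec Bool N → List (V N)
  centreNeighbours x = concat (centreBlocks x)

  aliceNeighbours : Vec Bool N → V N → List (V N)
  aliceNeighbours x (path zero) = centreNeighbours x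
  aliceNeighbours x (path 1F)   = path zero ∷ path 2F ∷ []
  aliceNeighbours x (path 2F)   = path 1F ∷ path 3F ∷ []
  aliceNeighbours x (path 3F)   = path 2F ∷ path 4F ∷ []
  aliceNeighbours x (path 4F)   = path 3F ∷ path 5F ∷ []
  aliceNeighbours x (path 5F)   = path 4F ∷ []
  aliceNeighbours x (a2 i) with lookup x i
  ... | false = center ∷ []
  ... | true  = center ∷ a3 i ∷ []
  aliceNeighbours x (a3 i) with lookup x i
  ... | false = b1 i ∷ center ∷ []
  ... | true  = b1 i ∷ a2 i ∷ []
  aliceNeighbours x _ = []

  bobNeighbours : Vec Bool N → V N → List (V N)
  bobNeighbours y (b1 i) with lookup y i
  ... | false = a3 i ∷ b2 i ∷ b3 i ∷ []
  ... | true  = a3 i ∷ b2 i ∷ []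
  bobNeighbours y (b2 i) with lookup y i
  ... | false = b1 i ∷ []
  ... | true  = b1 i ∷ b3 i ∷ []
  bobNeighbours y (b3 i) with lookup y i
  ... | false = b1 i ∷ []
  ... | true  = b2 i ∷ []
  bobNeighbours y _ = []

  neighbours : Vec Bool N → Vec Bool N → V N → List (V N)
  neighbours x y v@(path _) = aliceNeighbours x v
  neighbours x y v@(a2 _)   = aliceNeighbours x v
  neighbours x y v@(a3 _)   = aliceNeighbours x v
  neighbours x y v@(b1 _)   = bobNeighbours y v
  neighbours x y v@(b2 _)   = bobNeighbours y v
  neighbours x y v@(b3 _)   = bobNeighbours y v

  module _ (x y : Vec Bool N) where

    target∈neighbours-source : ∀ {u v} → Arc x y u v → v ∈ neighbours x y u
    target∈neighbours-source (pathE zero) = here refl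
    target∈neighbours-source (pathE 1F)   = there (here refl)
    target∈neighbours-source (pathE 2F)   = there (here refl)
    target∈neighbours-source (pathE 3F)   = there (here refl)
    target∈neighbours-source (pathE 4F)   = there (here refl)
    target∈neighbours-source (a3-b1 i) with lookup x i
    ... | false = here refl
    ... | true  = here refl
    target∈neighbours-source (c-a2 i) =
      ∈-concat⁺′ {xss = centreBlocks x} (∈-map⁺ a2 (∈-allFin i)) (there (here refl))
    target∈neighbours-source (c-a3 i x≡0) =
      ∈-concat⁺′ {xss = centreBlocks x} (∈-map∘filter⁺ a3 (zeroAt? x) (i , ∈-allFin i , refl , x≡0))
                 (there (there (here refl)))
    target∈neighbours-source (a2-a3 i x≡1) rewrite x≡1 = there (here refl)
    target∈neighbours-source (b1-b2 i) with lookup y i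
    ... | false = there (here refl)
    ... | true  = there (here refl)
    target∈neighbours-source (b1-b3 i y≡0) rewrite y≡0 = there (there (here refl))
    target∈neighbours-source (b2-b3 i y≡1) rewrite y≡1 = there (here refl)

    source∈neighbours-target : ∀ {u v} → Arc x y u v → u ∈ neighbours x y v
    source∈neighbours-target (pathE zero) = here refl
    source∈neighbours-target (pathE 1F)   = here refl
    source∈neighbours-target (pathE 2F)   = here refl
    source∈neighbours-target (pathE 3F)   = here refl
    source∈neighbours-target (pathE 4F)   = here refl
    source∈neighbours-target (a3-b1 i) with lookup y i
    ... | false = here refl
    ... | true  = here refl
    source∈neighbours-target (c-a2 i) with lookup x i
    ... | false = here refl
    ... | true  = here refl
    source∈neighbours-target (c-a3 i x≡0) rewrite x≡0 = there (here refl)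
    source∈neighbours-target (a2-a3 i x≡1) rewrite x≡1 = there (here refl)
    source∈neighbours-target (b1-b2 i) with lookup y i
    ... | false = here refl
    ... | true  = here refl
    source∈neighbours-target (b1-b3 i y≡0) rewrite y≡0 = here refl
    source∈neighbours-target (b2-b3 i y≡1) rewrite y≡1 = here refl

    ∈-centreNeighbours⇒Adj : ∀ {v} → v ∈ centreNeighbours x → Adj x y center v
    ∈-centreNeighbours⇒Adj v∈ with ∈-concat⁻ (centreBlocks x) v∈
    ... | here (here refl) = inj₁ (pathE zero)
    ... | there (here a2∈) with ∈-map⁻ a2 a2∈
    ...   | i , _ , refl = inj₁ (c-a2 i)
    ∈-centreNeighbours⇒Adj v∈ | there (there (here a3∈)) with ∈-map∘filter⁻ a3 (zeroAt? x) {xs = indices} a3∈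
    ...   | i , _ , refl , x≡0 = inj₁ (c-a3 i x≡0)

    ∈-neighbours⇒Adj : ∀ u {v} → v ∈ neighbours x y u → Adj x y u v
    ∈-neighbours⇒Adj (path zero) v∈                = ∈-centreNeighbours⇒Adj v∈
    ∈-neighbours⇒Adj (path 1F) (here refl)         = inj₂ (pathE zero)
    ∈-neighbours⇒Adj (path 1F) (there (here refl)) = inj₁ (pathE 1F)
    ∈-neighbours⇒Adj (path 2F) (here refl)         = inj₂ (pathE 1F)
    ∈-neighbours⇒Adj (path 2F) (there (here refl)) = inj₁ (pathE 2F)
    ∈-neighbours⇒Adj (path 3F) (here refl)         = inj₂ (pathE 2F)
    ∈-neighbours⇒Adj (path 3F) (there (here refl)) = inj₁ (pathE 3F)
    ∈-neighbours⇒Adj (path 4F) (here refl)         = inj₂ (pathE 3F)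
    ∈-neighbours⇒Adj (path 4F) (there (here refl)) = inj₁ (pathE 4F)
    ∈-neighbours⇒Adj (path 5F) (here refl)         = inj₂ (pathE 4F)
    ∈-neighbours⇒Adj (a2 i) v∈ with lookup x i in x≡
    ∈-neighbours⇒Adj (a2 i) (here refl)         | false = inj₂ (c-a2 i)
    ∈-neighbours⇒Adj (a2 i) (here refl)         | true  = inj₂ (c-a2 i)
    ∈-neighbours⇒Adj (a2 i) (there (here refl)) | true  = inj₁ (a2-a3 i x≡)
    ∈-neighbours⇒Adj (a3 i) v∈ with lookup x i in x≡
    ∈-neighbours⇒Adj (a3 i) (here refl)         | false = inj₁ (a3-b1 i)
    ∈-neighbours⇒Adj (a3 i) (here refl)         | true  = inj₁ (a3-b1 i)
    ∈-neighbours⇒Adj (a3 i) (there (here refl)) | false = inj₂ (c-a3 i x≡)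
    ∈-neighbours⇒Adj (a3 i) (there (here refl)) | true  = inj₂ (a2-a3 i x≡)
    ∈-neighbours⇒Adj (b1 i) v∈ with lookup y i in y≡
    ∈-neighbours⇒Adj (b1 i) (here refl)                 | false = inj₂ (a3-b1 i)
    ∈-neighbours⇒Adj (b1 i) (here refl)                 | true  = inj₂ (a3-b1 i)
    ∈-neighbours⇒Adj (b1 i) (there (here refl))         | false = inj₁ (b1-b2 i)
    ∈-neighbours⇒Adj (b1 i) (there (here refl))         | true  = inj₁ (b1-b2 i)
    ∈-neighbours⇒Adj (b1 i) (there (there (here refl))) | false = inj₁ (b1-b3 i y≡)
    ∈-neighbours⇒Adj (b2 i) v∈ with lookup y i in y≡
    ∈-neighbours⇒Adj (b2 i) (here refl)         | false = inj₂ (b1-b2 i)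
    ∈-neighbours⇒Adj (b2 i) (here refl)         | true  = inj₂ (b1-b2 i)
    ∈-neighbours⇒Adj (b2 i) (there (here refl)) | true  = inj₁ (b2-b3 i y≡)
    ∈-neighbours⇒Adj (b3 i) v∈ with lookup y i in y≡
    ∈-neighbours⇒Adj (b3 i) (here refl) | false = inj₂ (b1-b3 i y≡)
    ∈-neighbours⇒Adj (b3 i) (here refl) | true  = inj₂ (b2-b3 i y≡)

    neighbours-unique : ∀ v → Unique (neighbours x y v)
    neighbours-unique (path zero) =
      Unique.concat⁺ {xss = centreBlocks x}
        ( ([] ∷ []) ∷ map-allFin-unique (λ { refl → refl })
        ∷ Unique.map⁺ (λ { refl → refl }) (Unique.filter⁺ (zeroAt? x) (Unique.allFin⁺ N)) ∷ [])
        ( (map-disjoint {f = path} (λ ()) ∷ map-disjoint {f = path} (λ ()) ∷ [])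
        ∷ (map-disjoint (λ ()) ∷ []) ∷ [] ∷ [])
    neighbours-unique (path 1F) = ((λ ()) ∷ []) ∷ [] ∷ []
    neighbours-unique (path 2F) = ((λ ()) ∷ []) ∷ [] ∷ []
    neighbours-unique (path 3F) = ((λ ()) ∷ []) ∷ [] ∷ []
    neighbours-unique (path 4F) = ((λ ()) ∷ []) ∷ [] ∷ []
    neighbours-unique (path 5F) = [] ∷ []
    neighbours-unique (a2 i) with lookup x i
    ... | false = [] ∷ []
    ... | true  = ((λ ()) ∷ []) ∷ [] ∷ []
    neighbours-unique (a3 i) with lookup x i
    ... | false = ((λ ()) ∷ []) ∷ [] ∷ []
    ... | true  = ((λ ()) ∷ []) ∷ [] ∷ []
    neighbours-unique (b1 i) with lookup y i
    ... | false = ((λ ()) ∷ (λ ()) ∷ []) ∷ ((λ ()) ∷ []) ∷ [] ∷ []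
    ... | true  = ((λ ()) ∷ []) ∷ [] ∷ []
    neighbours-unique (b2 i) with lookup y i
    ... | false = [] ∷ []
    ... | true  = ((λ ()) ∷ []) ∷ [] ∷ []
    neighbours-unique (b3 i) with lookup y i
    ... | false = [] ∷ []
    ... | true  = [] ∷ []

    neighbours-correct : ∀ v → Unique (neighbours x y v) × (∀ u → (u ∈ neighbours x y v) ⇔ Adj x y v u)
    neighbours-correct v = neighbours-unique v ,
      λ u → mk⇔ (∈-neighbours⇒Adj v) [ target∈neighbours-source , source∈neighbours-target ]

  aliceBlocks bobBlocks : List (List (V N))
  aliceBlocks = map path (allFin 6) ∷ arms a2 ∷ arms a3 ∷ []
  bobBlocks   = arms b1 ∷ arms b2 ∷ arms b3 ∷ []

  vertices : List (V N)
  vertices = concat (aliceBlocks ++ bobBlocks)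

  vertices-unique : Unique vertices
  vertices-unique =
    Unique.concat⁺ {xss = aliceBlocks ++ bobBlocks}
      ( map-allFin-unique {c = path} (λ { refl → refl }) ∷ map-allFin-unique (λ { refl → refl })
      ∷ map-allFin-unique (λ { refl → refl }) ∷ map-allFin-unique (λ { refl → refl })
      ∷ map-allFin-unique (λ { refl → refl }) ∷ map-allFin-unique (λ { refl → refl }) ∷ [])
      ( ( map-disjoint {f = path} (λ ()) ∷ map-disjoint {f = path} (λ ()) ∷ map-disjoint {f = path} (λ ())
        ∷ map-disjoint {f = path} (λ ()) ∷ map-disjoint {f = path} (λ ()) ∷ [])
      ∷ (map-disjoint (λ ()) ∷ map-disjoint (λ ()) ∷ map-disjoint (λ ()) ∷ map-disjoint (λ ()) ∷ [])
      ∷ (map-disjoint (λ ()) ∷ map-disjoint (λ ()) ∷ map-disjoint (λ ()) ∷ [])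
      ∷ (map-disjoint (λ ()) ∷ map-disjoint (λ ()) ∷ [])
      ∷ (map-disjoint (λ ()) ∷ []) ∷ [] ∷ [])

  private
    in-block : ∀ {v vs} → v ∈ vs → vs ∈ aliceBlocks ++ bobBlocks → v ∈ vertices
    in-block = ∈-concat⁺′

  ∈-vertices : ∀ v → v ∈ vertices
  ∈-vertices (path k) = in-block (∈-map⁺ path (∈-allFin k)) (here refl)
  ∈-vertices (a2 i)   = in-block (∈-map⁺ a2 (∈-allFin i)) (there (here refl))
  ∈-vertices (a3 i)   = in-block (∈-map⁺ a3 (∈-allFin i)) (there (there (here refl)))
  ∈-vertices (b1 i)   = in-block (∈-map⁺ b1 (∈-allFin i)) (there (there (there (here refl))))
  ∈-vertices (b2 i)   = in-block (∈-map⁺ b2 (∈-allFin i)) (there (there (there (there (here refl)))))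
  ∈-vertices (b3 i)   = in-block (∈-map⁺ b3 (∈-allFin i)) (there (there (there (there (there (here refl))))))

  itemsOver : (V N → List (V N)) → List (V N) → List (Item N)
  itemsOver nbrs = map (λ v → v , nbrs v)

  map-proj₁-itemsOver : ∀ nbrs vs → map proj₁ (itemsOver nbrs vs) ≡ vs
  map-proj₁-itemsOver nbrs vs = trans (sym (map-∘ vs)) (map-id vs)

  aliceItems bobItems : Vec Bool N → List (Item N)
  aliceItems x = itemsOver (aliceNeighbours x) (concat aliceBlocks)
  bobItems   y = itemsOver (bobNeighbours y) (concat bobBlocks)

  windmillStream : Vec Bool N → Vec Bool N → List (Item N)
  windmillStream x y = aliceItems x ++ bobItems y

  module _ (x y : Vec Bool N) where

    windmillStream-vertices : map proj₁ (windmillStream x y) ≡ vertices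
    windmillStream-vertices = begin
      map proj₁ (aliceItems x ++ bobItems y)               ≡⟨ map-++ proj₁ (aliceItems x) (bobItems y) ⟩
      map proj₁ (aliceItems x) ++ map proj₁ (bobItems y)   ≡⟨ cong₂ _++_ (map-proj₁-itemsOver _ (concat aliceBlocks))
                                                                           (map-proj₁-itemsOver _ (concat bobBlocks)) ⟩
      concat aliceBlocks ++ concat bobBlocks               ≡⟨ concat-++ aliceBlocks bobBlocks ⟩
      vertices                                             ∎
      where open ≡-Reasoning

    aliceNeighbours-agrees : ∀ {v} → v ∈ concat aliceBlocks → aliceNeighbours x v ≡ neighbours x y v
    aliceNeighbours-agrees v∈ with ∈-concat⁻ aliceBlocks v∈
    ... | here v∈path with ∈-map⁻ path v∈path
    ...   | _ , _ , refl = refl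
    aliceNeighbours-agrees v∈ | there (here v∈a2) with ∈-map⁻ a2 v∈a2
    ...   | _ , _ , refl = refl
    aliceNeighbours-agrees v∈ | there (there (here v∈a3)) with ∈-map⁻ a3 v∈a3
    ...   | _ , _ , refl = refl

    bobNeighbours-agrees : ∀ {v} → v ∈ concat bobBlocks → bobNeighbours y v ≡ neighbours x y v
    bobNeighbours-agrees v∈ with ∈-concat⁻ bobBlocks v∈
    ... | here v∈b1 with ∈-map⁻ b1 v∈b1
    ...   | _ , _ , refl = refl
    bobNeighbours-agrees v∈ | there (here v∈b2) with ∈-map⁻ b2 v∈b2
    ...   | _ , _ , refl = refl
    bobNeighbours-agrees v∈ | there (there (here v∈b3)) with ∈-map⁻ b3 v∈b3
    ...   | _ , _ , refl = refl

    ∈-windmillStream : ∀ {it} → it ∈ windmillStream x y → ∃[ v ] it ≡ (v , neighbours x y v)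
    ∈-windmillStream it∈ with ∈-++⁻ (aliceItems x) it∈
    ... | inj₁ it∈alice with ∈-map⁻ _ it∈alice
    ...   | v , v∈ , refl = v , cong (v ,_) (aliceNeighbours-agrees v∈)
    ∈-windmillStream it∈ | inj₂ it∈bob with ∈-map⁻ _ it∈bob
    ...   | v , v∈ , refl = v , cong (v ,_) (bobNeighbours-agrees v∈)

    windmillStream-valid : ValidStream x y (windmillStream x y)
    windmillStream-valid =
      subst Unique (sym windmillStream-vertices) vertices-unique ,
      (λ v → subst (v ∈_) (sym windmillStream-vertices) (∈-vertices v)) ,
      λ it it∈ → case ∈-windmillStream it∈ of λ { (v , refl) → neighbours-correct x y v }

-- armLength b is d(c, a_{i,3}) when x_i = b, and also d(b_{i,1}, b_{i,3}) when y_i = b.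
armLength : Bool → ℕ
armLength false = 1
armLength true  = 2

module _ {N : ℕ} (x y : Vec Bool N) where

  Adj-sym : ∀ {u v} → Adj x y u v → Adj x y v u
  Adj-sym = [ inj₂ , inj₁ ]

  _++ʷ_ : ∀ {u v w k m} → Walk x y u v k → Walk x y v w m → Walk x y u w (k + m)
  nil      ++ʷ q = q
  cons e p ++ʷ q = cons e (p ++ʷ q)

  reverseOnto : ∀ {u v w k m} → Walk x y u v k → Walk x y u w m → Walk x y v w (k + m)
  reverseOnto nil acc = acc
  reverseOnto {k = suc k} {m} (cons e p) acc =
    subst (Walk x y _ _) (+-suc k m) (reverseOnto p (cons (Adj-sym e) acc))

  reverseʷ : ∀ {u v k} → Walk x y u v k → Walk x y v u k
  reverseʷ {k = k} p = subst (Walk x y _ _) (+-identityʳ k) (reverseOnto p nil)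

  depth : V N → ℕ
  depth (path k) = toℕ k
  depth (a2 i)   = 1
  depth (a3 i)   = armLength (lookup x i)
  depth (b1 i)   = suc (armLength (lookup x i))
  depth (b2 i)   = suc (suc (armLength (lookup x i)))
  depth (b3 i)   = armLength (lookup y i) + suc (armLength (lookup x i))

  a3-to-centre : ∀ i → Walk x y (a3 i) center (armLength (lookup x i))
  a3-to-centre i with lookup x i in x≡
  ... | false = cons (inj₂ (c-a3 i x≡)) nil
  ... | true  = cons (inj₂ (a2-a3 i x≡)) (cons (inj₂ (c-a2 i)) nil)

  b3-to-b1 : ∀ i → Walk x y (b3 i) (b1 i) (armLength (lookup y i))
  b3-to-b1 i with lookup y i in y≡
  ... | false = cons (inj₂ (b1-b3 i y≡)) nil
  ... | true  = cons (inj₂ (b2-b3 i y≡)) (cons (inj₂ (b1-b2 i)) nil)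

  down : ∀ {v k} (j : Fin 5) → Walk x y (path (inject₁ j)) v k → Walk x y (path (suc j)) v (suc k)
  down j = cons (inj₂ (pathE j))

  to-centre : ∀ v → Walk x y v center (depth v)
  to-centre (path zero) = nil
  to-centre (path 1F)   = down zero nil
  to-centre (path 2F)   = down 1F (down zero nil)
  to-centre (path 3F)   = down 2F (down 1F (down zero nil))
  to-centre (path 4F)   = down 3F (down 2F (down 1F (down zero nil)))
  to-centre (path 5F)   = down 4F (down 3F (down 2F (down 1F (down zero nil))))
  to-centre (a2 i)      = cons (inj₂ (c-a2 i)) nil
  to-centre (a3 i)      = a3-to-centre i
  to-centre (b1 i)      = cons (inj₂ (a3-b1 i)) (a3-to-centre i)
  to-centre (b2 i)      = cons (inj₂ (b1-b2 i)) (to-centre (b1 i))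
  to-centre (b3 i)      = b3-to-b1 i ++ʷ to-centre (b1 i)

  via-centre : ∀ s t → Walk x y s t (depth s + depth t)
  via-centre s t = to-centre s ++ʷ reverseʷ (to-centre t)

  -- height v = d(path 5F, v).
  height : V N → ℕ
  height (path k) = 5 ∸ toℕ k
  height v        = 5 + depth v

  height-Arc : ∀ {u v} → Arc x y u v → height v ≤ suc (height u) × height u ≤ suc (height v)
  height-Arc (pathE zero) = ≤-decide , ≤-decide
  height-Arc (pathE 1F)   = ≤-decide , ≤-decide
  height-Arc (pathE 2F)   = ≤-decide , ≤-decide
  height-Arc (pathE 3F)   = ≤-decide , ≤-decide
  height-Arc (pathE 4F)   = ≤-decide , ≤-decide
  height-Arc (a3-b1 i) with lookup x i
  ... | false = ≤-decide , ≤-decide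
  ... | true  = ≤-decide , ≤-decide
  height-Arc (c-a2 i) = ≤-decide , ≤-decide
  height-Arc (c-a3 i x≡0) rewrite x≡0 = ≤-decide , ≤-decide
  height-Arc (a2-a3 i x≡1) rewrite x≡1 = ≤-decide , ≤-decide
  height-Arc (b1-b2 i) with lookup x i
  ... | false = ≤-decide , ≤-decide
  ... | true  = ≤-decide , ≤-decide
  height-Arc (b1-b3 i y≡0) rewrite y≡0 with lookup x i
  ... | false = ≤-decide , ≤-decide
  ... | true  = ≤-decide , ≤-decide
  height-Arc (b2-b3 i y≡1) rewrite y≡1 with lookup x i
  ... | false = ≤-decide , ≤-decide
  ... | true  = ≤-decide , ≤-decide

  height-Adj : ∀ {u v} → Adj x y u v → height v ≤ suc (height u)
  height-Adj = [ proj₁ ∘ height-Arc , proj₂ ∘ height-Arc ]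

  height-Walk : ∀ {u w k} → Walk x y u w k → height w ≤ height u + k
  height-Walk {u} nil = ≤-reflexive (sym (+-identityʳ (height u)))
  height-Walk {u} {k = suc k} (cons e p) = begin
    _                  ≤⟨ height-Walk p ⟩
    _ + k              ≤⟨ +-monoˡ-≤ k (height-Adj e) ⟩
    suc (height u) + k ≡⟨ sym (+-suc (height u) k) ⟩
    height u + suc k   ∎
    where open ≤-Reasoning

  diameter-≥10 : ∀ i → lookup x i ≡ true → lookup y i ≡ true → ∀ {d} → IsDiameter x y d → 10 ≤ d
  diameter-≥10 i x≡1 y≡1 (_ , maximal) = maximal (path 5F) (b3 i) 10 (walk , shortest)
    where
    height-b3 : height (b3 i) ≡ 10
    height-b3 rewrite x≡1 | y≡1 = refl
    walk : Walk x y (path 5F) (b3 i) 10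
    walk = subst (Walk x y _ _) height-b3 (via-centre (path 5F) (b3 i))
    shortest : ∀ k → Walk x y (path 5F) (b3 i) k → 10 ≤ k
    shortest k p = subst (_≤ k) height-b3 (height-Walk p)

  DisjointSupports : Set
  DisjointSupports = ∀ i → lookup x i ≡ true → lookup y i ≡ true → ⊥

  depth-≤5 : ∀ v → depth v ≤ 5
  depth-≤5 (path zero) = ≤-decide
  depth-≤5 (path 1F)   = ≤-decide
  depth-≤5 (path 2F)   = ≤-decide
  depth-≤5 (path 3F)   = ≤-decide
  depth-≤5 (path 4F)   = ≤-decide
  depth-≤5 (path 5F)   = ≤-decide
  depth-≤5 (a2 i)      = ≤-decide
  depth-≤5 (a3 i) with lookup x i
  ... | false = ≤-decide
  ... | true  = ≤-decide
  depth-≤5 (b1 i) with lookup x i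
  ... | false = ≤-decide
  ... | true  = ≤-decide
  depth-≤5 (b2 i) with lookup x i
  ... | false = ≤-decide
  ... | true  = ≤-decide
  depth-≤5 (b3 i) with lookup x i | lookup y i
  ... | false | false = ≤-decide
  ... | false | true  = ≤-decide
  ... | true  | false = ≤-decide
  ... | true  | true  = ≤-decide

  depth-≤4 : DisjointSupports → ∀ v → v ≡ path 5F ⊎ depth v ≤ 4
  depth-≤4 _ (path zero) = inj₂ ≤-decide
  depth-≤4 _ (path 1F)   = inj₂ ≤-decide
  depth-≤4 _ (path 2F)   = inj₂ ≤-decide
  depth-≤4 _ (path 3F)   = inj₂ ≤-decide
  depth-≤4 _ (path 4F)   = inj₂ ≤-decide
  depth-≤4 _ (path 5F)   = inj₁ refl
  depth-≤4 _ (a2 i)      = inj₂ ≤-decide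
  depth-≤4 _ (a3 i) with lookup x i
  ... | false = inj₂ ≤-decide
  ... | true  = inj₂ ≤-decide
  depth-≤4 _ (b1 i) with lookup x i
  ... | false = inj₂ ≤-decide
  ... | true  = inj₂ ≤-decide
  depth-≤4 _ (b2 i) with lookup x i
  ... | false = inj₂ ≤-decide
  ... | true  = inj₂ ≤-decide
  depth-≤4 disjoint (b3 i) with lookup x i in x≡ | lookup y i in y≡
  ... | false | false = inj₂ ≤-decide
  ... | false | true  = inj₂ ≤-decide
  ... | true  | false = inj₂ ≤-decide
  ... | true  | true  = ⊥-elim (disjoint i x≡ y≡)

  short-walk : DisjointSupports → ∀ s t → ∃[ k ] k ≤ 9 × Walk x y s t k
  short-walk disjoint s t with depth-≤4 disjoint s | depth-≤4 disjoint t
  ... | inj₁ refl | inj₁ refl = 0 , z≤n , nil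
  ... | inj₂ s≤4  | _         = _ , +-mono-≤ s≤4 (depth-≤5 t) , via-centre s t
  ... | inj₁ _    | inj₂ t≤4  = _ , +-mono-≤ (depth-≤5 s) t≤4 , via-centre s t

  diameter-≤9 : DisjointSupports → ∀ {d} → IsDiameter x y d → d ≤ 9
  diameter-≤9 disjoint ((s , t , _ , minimal) , _) with short-walk disjoint s t
  ... | k , k≤9 , walk = ≤-trans (minimal k walk) k≤9

complement : ∀ {N} → Vec Bool N → Vec Bool N
complement = Vec.map not

complement-disjoint : ∀ {N} (x : Vec Bool N) → DisjointSupports x (complement x)
complement-disjoint x i x≡1 ¬x≡1 with () ← trans (sym (cong not x≡1)) (trans (sym (lookup-map i not x)) ¬x≡1)

module _ {N p s : ℕ} (A : Algorithm N p s) (solves : SolvesDiameterOnWindmills A) where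
  open Algorithm A

  transcriptOf : Vec Bool N → Vec (Fin (2 ^ s) × Fin (2 ^ s)) (length (allFin p))
  transcriptOf x = transcript step (aliceItems x) (bobItems (complement x)) (allFin p) init

  transcriptOf-separates : ∀ x x′ i → lookup x i ≡ true → lookup x′ i ≡ false → transcriptOf x ≢ transcriptOf x′
  transcriptOf-separates x x′ i x≡1 x′≡0 same =
    1+n≰n (≤-trans (diameter-≥10 x (complement x′) i x≡1 y≡1 spliced)
                  (diameter-≤9 x (complement x) (complement-disjoint x) (diameterOf (complement x))))
    where
    diameterOf : ∀ y → IsDiameter x y (run A (windmillStream x y))
    diameterOf y = solves x y (windmillStream x y) (windmillStream-valid x y)
    y≡1 : lookup (complement x′) i ≡ true
    y≡1 = trans (lookup-map i not x′) (cong not x′≡0)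
    spliced : IsDiameter x (complement x′) (run A (windmillStream x (complement x)))
    spliced = subst (IsDiameter x (complement x′))
      (cong output (runPasses-splice step (aliceItems x) (bobItems (complement x))
                                          (aliceItems x′) (bobItems (complement x′)) (allFin p) init same))
      (diameterOf (complement x′))

  transcriptOf-injective : ∀ {x x′} → transcriptOf x ≡ transcriptOf x′ → x ≡ x′
  transcriptOf-injective {x} {x′} same =
    trans (sym (tabulate∘lookup x)) (trans (tabulate-cong agree) (tabulate∘lookup x′))
    where
    agree : ∀ i → lookup x i ≡ lookup x′ i
    agree i with lookup x i in x≡ | lookup x′ i in x′≡
    ... | false | false = refl
    ... | true  | true  = refl
    ... | true  | false = ⊥-elim (transcriptOf-separates x x′ i x≡ x′≡ same)
    ... | false | true  = ⊥-elim (transcriptOf-separates x′ x i x′≡ x≡ (sym same))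

  memory-bound : N ≤ (s + s) * p
  memory-bound = ^-cancelˡ-≤ 2 ≤-decide (begin
    2 ^ N                                    ≤⟨ Vec-↣⇒^≤ 2↔Bool *↔× (mk↣ transcriptOf-injective) ⟩
    (2 ^ s * 2 ^ s) ^ length (allFin p)      ≡⟨ cong ((2 ^ s * 2 ^ s) ^_) (length-tabulate {n = p} id) ⟩
    (2 ^ s * 2 ^ s) ^ p                      ≡⟨ cong (_^ p) (sym (^-distribˡ-+-* 2 s s)) ⟩
    (2 ^ (s + s)) ^ p                        ≡⟨ ^-*-assoc 2 (s + s) p ⟩
    2 ^ ((s + s) * p)                        ∎)
    where open ≤-Reasoning

windmill-size-bound : ∀ {N p s} → 1 ≤ N → N ≤ (s + s) * p → 1 * (5 * N + 6) ≤ 22 * (p * s)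
windmill-size-bound {N} {p} {s} 1≤N N≤2sp = begin
  1 * (5 * N + 6)    ≡⟨ *-identityˡ (5 * N + 6) ⟩
  5 * N + 6          ≤⟨ +-monoʳ-≤ (5 * N) (*-monoʳ-≤ 6 1≤N) ⟩
  5 * N + 6 * N      ≡⟨ sym (*-distribʳ-+ N 5 6) ⟩
  11 * N             ≤⟨ *-monoʳ-≤ 11 N≤2sp ⟩
  11 * ((s + s) * p) ≡⟨ eleven-twos p s ⟩
  22 * (p * s)       ∎
  where
  open ≤-Reasoning
  eleven-twos : ∀ p s → 11 * ((s + s) * p) ≡ 22 * (p * s)
  eleven-twos = solve-∀

theorem21 : ∃[ a ] ∃[ b ] (0 < a × 0 < b × ∃[ N₀ ] (∀ N → N₀ ≤ N →
              ∀ p → 1 ≤ p → ∀ s → (A : Algorithm N p s) →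
              SolvesDiameterOnWindmills A →
              a * (5 * N + 6) ≤ b * (p * s)))
theorem21 = 1 , 22 , ≤-decide , ≤-decide , 1 ,
  λ N 1≤N p _ s A solves → windmill-size-bound {p = p} {s} 1≤N (memory-bound A solves)
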